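{- Let $m$ be a positive integer and $a_1,\ldots,a_{2m-1}$ positive integers. If $$q_{2m-2}(a_2,\ldots,a_{2m-1})=2\,q_{2m-2}(a_1,\ldots,a_{2m-2}),$$ then $a_j=1$ for some $j\in\{1,\ldots,2m-1\}$.
   Context: The polynomials $q_n\in\mathbb{Z}[x_1,\ldots,x_n]$ are defined by $q_{ -1}=0$, $q_0=1$ and $q_n(x_1,\ldots,x_n)=x_nq_{n-1}(x_1,\ldots,x_{n-1})+q_{n-2}(x_1,\ldots,x_{n-2})$ for $n\ge1$ (with $q_0=1$ for the empty argument list). -}

module Defs where

open import Data.Nat using (ℕ; zero; suc; _+_; _*_)
open import Data.Fin using (Fin; fromℕ; inject₁)
open import Function using (_∘_)

-- The continuant polynomial q_n evaluated at (x_1,…,x_n), where x_i = x (i-1).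
-- q_0 = 1, q_{-1} = 0, q_n = x_n q_{n-1}(x_1..x_{n-1}) + q_{n-2}(x_1..x_{n-2}).
q : (n : ℕ) → (Fin n → ℕ) → ℕ
q zero _ = 1
q (suc zero) x = x (fromℕ zero) * 1 + 0
q (suc (suc n)) x =
  x (fromℕ (suc n)) * q (suc n) (x ∘ inject₁) + q n (x ∘ inject₁ ∘ inject₁)

-- Suppose every a_j ≥ 2. For a sequence f_0, …, f_{2k} of entries ≥ 2 neither
-- q_{2k}(f_1,…,f_{2k}) = 2 q_{2k}(f_0,…,f_{2k-1}) nor the same with the two sides exchanged,
-- by induction on k. Expanding the length-(2k+2) continuants at their last, resp. first, entry
-- writes both sides of such an equation as a multiple of C = q_{2k+1}(f_1,…,f_{2k+1}) plus a
-- remainder in (0, C]; the remainders must then agree, and that is the exchanged equation for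
-- f_1, …, f_{2k+1}. For k = 0 the equation reads 1 = 2.
module Submission where

open import Defs
open import Data.Nat using (ℕ; zero; suc; _+_; _*_; _∸_; _≤_; _<_; _%_; z≤n; s≤s; _≟_)
open import Data.Nat.Properties
open import Data.Nat.DivMod using ([m+kn]%n≡m%n; m<n⇒m%n≡m)
open import Data.Nat.Tactic.RingSolver using (solve-∀)
open import Data.Fin using (Fin; toℕ; fromℕ; inject₁; fromℕ<)
open import Data.Fin.Properties using (toℕ-fromℕ; toℕ-inject₁; toℕ<n; toℕ-fromℕ<; any?)
open import Data.Product using (∃; _×_; _,_; proj₁; proj₂)
open import Data.Empty using (⊥-elim)
open import Relation.Nullary using (yes; no)
open import Relation.Binary.PropositionalEquality
open import Function using (_∘_)

positive-remainder-unique : ∀ u v {C x y} → 1 ≤ x → x ≤ C → 1 ≤ y → y ≤ C →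
                            u * C + x ≡ v * C + y → x ≡ y
positive-remainder-unique u v {suc C} {suc x} {suc y} (s≤s z≤n) (s≤s x≤C) (s≤s z≤n) (s≤s y≤C) eq =
  cong suc (begin
    x                        ≡⟨ m<n⇒m%n≡m (s≤s x≤C) ⟨
    x % suc C                ≡⟨ [m+kn]%n≡m%n x u (suc C) ⟨
    (x + u * suc C) % suc C  ≡⟨ cong (_% suc C) shifted ⟩
    (y + v * suc C) % suc C  ≡⟨ [m+kn]%n≡m%n y v (suc C) ⟩
    y % suc C                ≡⟨ m<n⇒m%n≡m (s≤s y≤C) ⟩
    y                        ∎)
  where
  open ≡-Reasoning
  shifted : x + u * suc C ≡ y + v * suc C
  shifted = suc-injective (trans (+-comm (suc x) (u * suc C)) (trans eq (+-comm (v * suc C) (suc y))))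

-- `continuant (suc n) f` is q_n (f 0, …, f (n ∸ 1)), and `continuant 0 f` is q_{-1} = 0.
continuant : ℕ → (ℕ → ℕ) → ℕ
continuant zero          f = 0
continuant (suc zero)    f = 1
continuant (suc (suc n)) f = f n * continuant (suc n) f + continuant n f

shift : (ℕ → ℕ) → ℕ → ℕ
shift f i = f (suc i)

q≡continuant : ∀ n (x : Fin n → ℕ) (f : ℕ → ℕ) → (∀ i → x i ≡ f (toℕ i)) →
               q n x ≡ continuant (suc n) f
q≡continuant zero          x f x≗f = refl
q≡continuant (suc zero)    x f x≗f = cong (λ t → t * 1 + 0) (x≗f (fromℕ zero))
q≡continuant (suc (suc n)) x f x≗f =
  cong₂ _+_ (cong₂ _*_ (trans (x≗f (fromℕ (suc n))) (cong f (toℕ-fromℕ (suc n))))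
                       (q≡continuant (suc n) (x ∘ inject₁) f x∘inject₁≗f))
            (q≡continuant n (x ∘ inject₁ ∘ inject₁) f x∘inject₁∘inject₁≗f)
  where
  x∘inject₁≗f : ∀ i → x (inject₁ i) ≡ f (toℕ i)
  x∘inject₁≗f i = trans (x≗f (inject₁ i)) (cong f (toℕ-inject₁ i))
  x∘inject₁∘inject₁≗f : ∀ i → x (inject₁ (inject₁ i)) ≡ f (toℕ i)
  x∘inject₁∘inject₁≗f i = trans (x∘inject₁≗f (inject₁ i)) (cong f (toℕ-inject₁ i))

continuant-expandˡ : ∀ n f →
  continuant (suc (suc n)) f ≡ f 0 * continuant (suc n) (shift f) + continuant n (shift (shift f))
continuant-expandˡ zero          f = refl
continuant-expandˡ (suc zero)    f = commute (f 1) (f 0)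
  where
  commute : ∀ a b → a * (b * 1 + 0) + 1 ≡ b * (a * 1 + 0) + 1
  commute = solve-∀
continuant-expandˡ (suc (suc n)) f = begin
    f (2 + n) * continuant (3 + n) f + continuant (2 + n) f
  ≡⟨ cong₂ (λ s t → f (2 + n) * s + t) (continuant-expandˡ (suc n) f) (continuant-expandˡ n f) ⟩
    f (2 + n) * (f 0 * continuant (2 + n) g + continuant (1 + n) (shift g))
      + (f 0 * continuant (1 + n) g + continuant n (shift g))
  ≡⟨ regroup (f (2 + n)) (f 0) _ _ _ _ ⟩
    f 0 * (f (2 + n) * continuant (2 + n) g + continuant (1 + n) g)
      + (f (2 + n) * continuant (1 + n) (shift g) + continuant n (shift g))
  ∎
  where
  open ≡-Reasoning
  g : ℕ → ℕ
  g = shift f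
  regroup : ∀ u v A B C D → u * (v * A + B) + (v * C + D) ≡ v * (u * A + C) + (u * B + D)
  regroup = solve-∀

continuant-positive : ∀ n f → (∀ i → i < n → 1 ≤ f i) → 1 ≤ continuant (suc n) f
continuant-positive zero    f f≥1 = ≤-refl
continuant-positive (suc n) f f≥1 =
  ≤-trans (*-mono-≤ (f≥1 n ≤-refl) (continuant-positive n f (λ i i<n → f≥1 i (m≤n⇒m≤1+n i<n))))
          (m≤m+n _ _)

continuant-doublesʳ : ∀ n f → 2 ≤ f n → 2 * continuant (suc n) f ≤ continuant (suc (suc n)) f
continuant-doublesʳ n f fₙ≥2 = ≤-trans (*-monoˡ-≤ (continuant (suc n) f) fₙ≥2) (m≤m+n _ _)

continuant-doublesˡ : ∀ n f → 2 ≤ f 0 → 2 * continuant (suc n) (shift f) ≤ continuant (suc (suc n)) f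
continuant-doublesˡ n f f₀≥2 = subst (2 * continuant (suc n) (shift f) ≤_) (sym (continuant-expandˡ n f))
  (≤-trans (*-monoˡ-≤ (continuant (suc n) (shift f)) f₀≥2) (m≤m+n _ _))

double-affine : ∀ v C z → 2 * (v * C + z) ≡ 2 * v * C + 2 * z
double-affine = solve-∀

-- The length is written k * 2 so that suc k * 2 reduces to suc (suc (k * 2)).
continuant-not-halved : ∀ k f → (∀ i → i ≤ k * 2 → 2 ≤ f i) →
    continuant (suc (k * 2)) (shift f) ≢ 2 * continuant (suc (k * 2)) f
  × continuant (suc (k * 2)) f ≢ 2 * continuant (suc (k * 2)) (shift f)
continuant-not-halved zero    f f≥2 = (λ ()) , (λ ())
continuant-not-halved (suc k) f f≥2 = shift-not-double , not-double-shift
  where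
  g : ℕ → ℕ
  g = shift f
  n C y z : ℕ
  n = k * 2
  C = continuant (suc (suc n)) g
  y = continuant (suc n) g
  z = continuant (suc n) (shift g)

  g≥2 : ∀ i → i ≤ suc n → 2 ≤ g i
  g≥2 i i≤1+n = f≥2 (suc i) (s≤s i≤1+n)

  g≥1 : ∀ i → i ≤ suc n → 1 ≤ g i
  g≥1 i i≤1+n = ≤-trans (s≤s z≤n) (g≥2 i i≤1+n)

  y≥1 : 1 ≤ y
  y≥1 = continuant-positive n g (λ i i<n → g≥1 i (m≤n⇒m≤1+n (<⇒≤ i<n)))

  z≥1 : 1 ≤ z
  z≥1 = continuant-positive n (shift g) (λ i i<n → g≥1 (suc i) (m≤n⇒m≤1+n i<n))

  2y≤C : 2 * y ≤ C
  2y≤C = continuant-doublesʳ n g (g≥2 n (n≤1+n n))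

  2z≤C : 2 * z ≤ C
  2z≤C = continuant-doublesˡ n g (g≥2 0 z≤n)

  ≤double : ∀ w → w ≤ 2 * w
  ≤double w = m≤m+n w (w + 0)

  y≤C : y ≤ C
  y≤C = ≤-trans (≤double y) 2y≤C

  z≤C : z ≤ C
  z≤C = ≤-trans (≤double z) 2z≤C

  2y≥1 : 1 ≤ 2 * y
  2y≥1 = ≤-trans y≥1 (≤double y)

  2z≥1 : 1 ≤ 2 * z
  2z≥1 = ≤-trans z≥1 (≤double z)

  g≥2-below : ∀ i → i ≤ n → 2 ≤ g i
  g≥2-below i i≤n = g≥2 i (m≤n⇒m≤1+n i≤n)

  shift-not-double : continuant (suc (suc k * 2)) g ≢ 2 * continuant (suc (suc k * 2)) f
  shift-not-double eq = proj₂ (continuant-not-halved k g g≥2-below)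
    (positive-remainder-unique (g (suc n)) (2 * f 0) y≥1 y≤C 2z≥1 2z≤C
      (trans eq (trans (cong (2 *_) (continuant-expandˡ (suc n) f)) (double-affine (f 0) C z))))

  not-double-shift : continuant (suc (suc k * 2)) f ≢ 2 * continuant (suc (suc k * 2)) g
  not-double-shift eq = proj₁ (continuant-not-halved k g g≥2-below)
    (positive-remainder-unique (f 0) (2 * g (suc n)) z≥1 z≤C 2y≥1 2y≤C
      (trans (sym (continuant-expandˡ (suc n) f)) (trans eq (double-affine (g (suc n)) C y))))

lemma4p3 : (m : ℕ) → 1 ≤ m → (a : ℕ → ℕ)
    → (∀ j → 1 ≤ j → j ≤ 2 * m ∸ 1 → 1 ≤ a j)
    → q (2 * m ∸ 2) (λ i → a (toℕ i + 2)) ≡ 2 * q (2 * m ∸ 2) (λ i → a (toℕ i + 1))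
    → ∃ λ j → (1 ≤ j × j ≤ 2 * m ∸ 1) × a j ≡ 1
lemma4p3 (suc m) _ a a≥1 hyp with any? (λ (i : Fin (2 * suc m ∸ 1)) → a (suc (toℕ i)) ≟ 1)
... | yes (i , aᵢ≡1) = suc (toℕ i) , (s≤s z≤n , toℕ<n i) , aᵢ≡1
... | no none≡1     = ⊥-elim (proj₁ (continuant-not-halved m f f≥2) halved)
  where
  f : ℕ → ℕ
  f = shift a

  f≥2 : ∀ i → i ≤ m * 2 → 2 ≤ f i
  f≥2 i i≤2m = ≤∧≢⇒< (a≥1 (suc i) (s≤s z≤n) in-range) λ 1≡aᵢ →
    none≡1 (fromℕ< in-range , subst (λ k → a (suc k) ≡ 1) (sym (toℕ-fromℕ< in-range)) (sym 1≡aᵢ))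
    where
    in-range : suc i ≤ 2 * suc m ∸ 1
    in-range = subst (suc i ≤_) (cong (_∸ 1) (*-comm (suc m) 2)) (s≤s i≤2m)

  halved : continuant (suc (m * 2)) (shift f) ≡ 2 * continuant (suc (m * 2)) f
  halved = subst (λ n → continuant (suc n) (shift f) ≡ 2 * continuant (suc n) f)
    (cong (_∸ 2) (*-comm 2 (suc m)))
    (trans (sym (q≡continuant (2 * suc m ∸ 2) _ (shift f) (λ i → cong a (+-comm (toℕ i) 2))))
           (trans hyp (cong (2 *_) (q≡continuant (2 * suc m ∸ 2) _ f (λ i → cong a (+-comm (toℕ i) 1))))))
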